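{- Let $n\ge 0$ and let $p$ be an odd prime. Then $o_{2,p}(n)\ge d_{2,p}(n)$ and $o_{2,p}(n)\equiv d_{2,p}(n)\pmod 2$.
   Context: A partition of $n$ is a weakly decreasing finite sequence of positive integers summing to $n$. $\mathcal O(n)$ is the set of partitions of $n$ with all parts odd, and $\mathcal D(n)$ the set of partitions of $n$ with all parts distinct. For a partition $\nu$ and positive integer $i$, $m_\nu(i)$ is the number of parts of $\nu$ equal to $i$. For $\lambda=(\lambda_1,\ldots,\lambda_\ell)$ with $\ell\ge2$, $\mathrm{pre}_2(\lambda)$ is the partition whose parts are the products $\lambda_i\lambda_j$ over all $1\le i<j\le\ell$ (with multiplicity); it is undefined if $\ell<2$. $o_{2,p}(n)$ is the total number of parts equal to $p$ among all partitions in the image $\mathrm{pre}_2(\mathcal O(n))$ (i.e. $\sum m_\nu(p)$ over $\nu=\mathrm{pre}_2(\lambda)$, $\lambda\in\mathcal O(n)$ with at least two parts), and $d_{2,p}(n)$ is defined likewise with $\mathcal D(n)$ in place of $\mathcal O(n)$. -}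

module Defs where

open import Data.Nat using (ℕ; zero; suc; _+_; _*_; _≤_; _<_; _≤ᵇ_; _≡ᵇ_)
open import Data.Nat.Divisibility using (_∣_)
open import Data.Bool using (Bool; true; false; _∧_; not; if_then_else_)
open import Data.List using (List; []; _∷_; map; concatMap; filter; length; upTo; _++_)
open import Data.Nat.ListAction using (sum)
open import Data.List.Relation.Unary.All using (All)
open import Data.List.Relation.Unary.Linked using (Linked)
open import Relation.Nullary.Decidable using (does)
open import Relation.Unary using (Decidable)

-- A partition is represented as a list of its parts in weakly decreasing order.

-- partsAtMost m n : all partitions of n whose parts are all ≤ m
-- (lists of positive integers, weakly decreasing, summing to n).
-- Defined by recursion on the fuel n+1 (fuel ≥ n + 1 suffices since each part is ≥ 1).
partsAtMostF : ℕ → ℕ → ℕ → List (List ℕ)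
partsAtMostF zero    m n = []
partsAtMostF (suc f) m zero = [] ∷ []
partsAtMostF (suc f) m (suc n) =
  concatMap (λ k → let a = suc k in
     if a ≤ᵇ suc n
       then map (a ∷_) (partsAtMostF f a (suc n Data.Nat.∸ a))
       else [])
    (upTo m)

partitions : ℕ → List (List ℕ)
partitions n = partsAtMostF (suc n) n n

isOdd : ℕ → Bool
isOdd n = (n Data.Nat.% 2) ≡ᵇ 1

allOdd : List ℕ → Bool
allOdd [] = true
allOdd (x ∷ xs) = isOdd x ∧ allOdd xs

-- For a weakly decreasing list, distinctness = strictly decreasing.
strictDec : List ℕ → Bool
strictDec [] = true
strictDec (x ∷ []) = true
strictDec (x ∷ y ∷ xs) = not (x ≤ᵇ y) ∧ strictDec (y ∷ xs)

oddPartitions : ℕ → List (List ℕ)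
oddPartitions n = Data.List.filterᵇ allOdd (partitions n)

distinctPartitions : ℕ → List (List ℕ)
distinctPartitions n = Data.List.filterᵇ strictDec (partitions n)

-- pre₂(λ): the multiset of products λᵢλⱼ, i < j (as a list; order irrelevant
-- for counting multiplicities).
pre₂ : List ℕ → List ℕ
pre₂ [] = []
pre₂ (x ∷ xs) = map (x *_) xs ++ pre₂ xs

mult : ℕ → List ℕ → ℕ
mult p ν = length (Data.List.filterᵇ (λ x → x ≡ᵇ p) ν)

-- Partitions with fewer than two parts have pre₂ undefined; they are excluded.
-- (For them our pre₂ gives [] which contributes 0 anyway, but we exclude explicitly.)
atLeastTwo : List ℕ → Bool
atLeastTwo (_ ∷ _ ∷ _) = true
atLeastTwo _ = false

countParts : ℕ → List (List ℕ) → ℕ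
countParts p Λ = sum (map (λ l → mult p (pre₂ l)) (Data.List.filterᵇ atLeastTwo Λ))

o₂ : ℕ → ℕ → ℕ
o₂ p n = countParts p (oddPartitions n)

d₂ : ℕ → ℕ → ℕ
d₂ p n = countParts p (distinctPartitions n)

-- For p prime, a product λᵢλⱼ equals p only for the pairs {1, p}, so o₂,p(n) and
-- d₂,p(n) are the sums of m₁(λ)·m_p(λ) over 𝒪(n) and over 𝒟(n).  On 𝒟(n) this is the
-- indicator of {1, p} ⊆ λ, with generating function q^(1+p) ∏_{d ≠ 1,p} (1 + q^d).
-- Writing 1 + q^d = (1 − q^(2d)) / (1 − q^d) as in Euler's proof of |𝒟(n)| = |𝒪(n)|
-- turns it, p being odd, into q/(1 − q²) · q^p/(1 − q^(2p)) · ∏_{odd d ≠ 1,p} 1/(1 − q^d),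
-- the generating function of (m₁ mod 2)(m_p mod 2) over 𝒪(n).  Hence
-- d₂,p(n) = Σ_{λ ∈ 𝒪(n)} (m₁ mod 2)(m_p mod 2), which is at most o₂,p(n) and has the
-- same parity.
--
-- Power series are coefficient functions ℕ → ℕ, so there is no division: Euler's
-- identity is proved by splitting off the odd part sizes and dilating q ↦ q², which
-- reduces the coefficient of qⁿ to coefficients of degree at most n/2.

module Submission where

open import Data.Bool using (Bool; true; false; if_then_else_; _∨_; _∧_)
open import Data.Bool.Properties using (∨-zeroʳ)
open import Data.List using (List; []; _∷_; _++_; [_]; map; concatMap; filterᵇ; replicate; upTo)
open import Data.List.Properties
  using (map-++; map-∘; map-cong; map-cong-local; concatMap-++; applyUpTo-∷ʳ; ++-identityʳ)
open import Data.List.Relation.Unary.All as All using (All; []; _∷_)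
open import Data.List.Relation.Unary.All.Properties using (applyUpTo⁺₁; concat⁺; map⁺)
open import Data.Nat
open import Data.Nat.DivMod using ([m+n]%n≡m%n; %-distribˡ-+; %-distribˡ-*; m%n≤m)
open import Data.Nat.Divisibility using (divides)
open import Data.Nat.Induction using (<-rec)
open import Data.Nat.ListAction using (sum)
open import Data.Nat.ListAction.Properties using (sum-++)
open import Data.Nat.Primality using (Prime; prime⇒irreducible; prime⇒nonTrivial)
open import Data.Nat.Properties
open import Data.Nat.Tactic.RingSolver using (solve-∀)
open import Data.Product using (_×_; _,_)
open import Data.Sum using ([_,_]′)
open import Function using (_∘_; const; id)
open import Relation.Binary.Definitions using (tri<; tri≈; tri>)
open import Relation.Binary.PropositionalEquality hiding ([_])
open import Relation.Nullary using (Dec; yes; no; contradiction)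
open import Relation.Nullary.Decidable using (dec-true; dec-false)

open import Defs

open ≡-Reasoning

-- Power series with natural coefficients

Series : Set
Series = ℕ → ℕ

δ₀ : Series
δ₀ zero    = 1
δ₀ (suc _) = 0

-- shift d X = q^d · X
shift : ℕ → Series → Series
shift d X n with d ≤? n
... | yes _ = X (n ∸ d)
... | no  _ = 0

shift-≤ : ∀ {d n} {X : Series} → d ≤ n → shift d X n ≡ X (n ∸ d)
shift-≤ {d} {n} d≤n with d ≤? n
... | yes _   = refl
... | no  d≰n = contradiction d≤n d≰n

shift-> : ∀ {d n} {X : Series} → n < d → shift d X n ≡ 0
shift-> {d} {n} n<d with d ≤? n
... | yes d≤n = contradiction d≤n (<⇒≱ n<d)
... | no  _   = refl

shift-cong : ∀ d {n} {X Y : Series} → (∀ {m} → m ≤ n → X m ≡ Y m) → shift d X n ≡ shift d Y n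
shift-cong d {n} eq with d ≤? n
... | yes _ = eq (m∸n≤m n d)
... | no  _ = refl

shift-cong< : ∀ {d n} {X Y : Series} → 0 < d → (∀ {m} → m < n → X m ≡ Y m) →
              shift d X n ≡ shift d Y n
shift-cong< {d} {n} d>0 eq with d ≤? n
... | yes d≤n = eq (∸-monoʳ-< d>0 d≤n)
... | no  _   = refl

shift-zero : ∀ d n → shift d (const 0) n ≡ 0
shift-zero d n with d ≤? n
... | yes _ = refl
... | no  _ = refl

shift-+ : ∀ d n (X Y : Series) → shift d (λ m → X m + Y m) n ≡ shift d X n + shift d Y n
shift-+ d n X Y with d ≤? n
... | yes _ = refl
... | no  _ = refl

shift-* : ∀ d n c (X : Series) → shift d (λ m → c * X m) n ≡ c * shift d X n
shift-* d n c X with d ≤? n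
... | yes _ = refl
... | no  _ = sym (*-zeroʳ c)

shift-shift : ∀ a b {n} {X : Series} → shift a (shift b X) n ≡ shift (a + b) X n
shift-shift a b {n} {X} with a + b ≤? n
... | yes a+b≤n = begin
  shift a (shift b X) n  ≡⟨ shift-≤ (m+n≤o⇒m≤o a a+b≤n) ⟩
  shift b X (n ∸ a)      ≡⟨ shift-≤ (m+n≤o⇒m≤o∸n b (subst (_≤ n) (+-comm a b) a+b≤n)) ⟩
  X (n ∸ a ∸ b)          ≡⟨ cong X (∸-+-assoc n a b) ⟩
  X (n ∸ (a + b))        ∎
... | no a+b≰n with a ≤? n
...   | no  _   = refl
...   | yes a≤n = shift-> (≰⇒> λ b≤n∸a →
        a+b≰n (subst (_≤ n) (+-comm b a) (m≤o∸n⇒m+n≤o b a≤n b≤n∸a)))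

shift-comm : ∀ a b {n} {X : Series} → shift a (shift b X) n ≡ shift b (shift a X) n
shift-comm a b {n} {X} =
  trans (shift-shift a b) (trans (cong (λ k → shift k X n) (+-comm a b)) (sym (shift-shift b a)))

shift-fixpoint-unique : ∀ {e} {A Z₁ Z₂ : Series} → 0 < e →
  (∀ n → Z₁ n ≡ A n + shift e Z₁ n) → (∀ n → Z₂ n ≡ A n + shift e Z₂ n) →
  ∀ n → Z₁ n ≡ Z₂ n
shift-fixpoint-unique {e} {A} {Z₁} {Z₂} e>0 eq₁ eq₂ = <-rec (λ n → Z₁ n ≡ Z₂ n) step
  where
  step : ∀ n → (∀ {m} → m < n → Z₁ m ≡ Z₂ m) → Z₁ n ≡ Z₂ n
  step n ih = trans (eq₁ n) (trans (cong (A n +_) (shift-cong< e>0 ih)) (sym (eq₂ n)))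

-- mulAt d φ X = X · Σⱼ φ j q^(j·d); any fuel c > n gives the coefficient of qⁿ.
mulAtFuel : ℕ → ℕ → (ℕ → ℕ) → Series → Series
mulAtFuel zero    d φ X n = 0
mulAtFuel (suc c) d φ X n = φ 0 * X n + shift d (mulAtFuel c d (φ ∘ suc) X) n

mulAt : ℕ → (ℕ → ℕ) → Series → Series
mulAt d φ X n = mulAtFuel (suc n) d φ X n

mulAtFuel-irrelevant : ∀ {d} → 0 < d → ∀ c c' φ X {n} → n < c → n < c' →
                   mulAtFuel c d φ X n ≡ mulAtFuel c' d φ X n
mulAtFuel-irrelevant d>0 (suc c) (suc c') φ X {n} (s≤s n≤c) (s≤s n≤c') =
  cong (φ 0 * X n +_) (shift-cong< d>0 λ m<n →
    mulAtFuel-irrelevant d>0 c c' (φ ∘ suc) X (<-≤-trans m<n n≤c) (<-≤-trans m<n n≤c'))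

mulAtFuel-zero : ∀ c d {φ} X n → (∀ j → φ j ≡ 0) → mulAtFuel c d φ X n ≡ 0
mulAtFuel-zero zero    d X n φ≡0 = refl
mulAtFuel-zero (suc c) d X n φ≡0 =
  cong₂ _+_ (cong (_* X n) (φ≡0 0))
    (trans (shift-cong d λ {m} _ → mulAtFuel-zero c d X m (φ≡0 ∘ suc)) (shift-zero d n))

mulAtFuel-congφ : ∀ c d {φ ψ} X n → (∀ j → φ j ≡ ψ j) → mulAtFuel c d φ X n ≡ mulAtFuel c d ψ X n
mulAtFuel-congφ zero    d X n φ≗ψ = refl
mulAtFuel-congφ (suc c) d X n φ≗ψ =
  cong₂ _+_ (cong (_* X n) (φ≗ψ 0)) (shift-cong d λ {m} _ → mulAtFuel-congφ c d X m (φ≗ψ ∘ suc))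

mulAtFuel-cong : ∀ c d φ {X Y} n → (∀ {m} → m ≤ n → X m ≡ Y m) →
                 mulAtFuel c d φ X n ≡ mulAtFuel c d φ Y n
mulAtFuel-cong zero    d φ n eq = refl
mulAtFuel-cong (suc c) d φ n eq =
  cong₂ _+_ (cong (φ 0 *_) (eq ≤-refl))
    (shift-cong d λ m≤n → mulAtFuel-cong c d (φ ∘ suc) _ λ k≤m → eq (≤-trans k≤m m≤n))

mulAtFuel-affine : ∀ c d φ k X Y n →
  mulAtFuel c d φ (λ m → k * X m + Y m) n ≡ k * mulAtFuel c d φ X n + mulAtFuel c d φ Y n
mulAtFuel-affine zero d φ k X Y n = sym (trans (+-identityʳ (k * 0)) (*-zeroʳ k))
mulAtFuel-affine (suc c) d φ k X Y n = begin
  φ 0 * (k * X n + Y n) + shift d (F (λ m → k * X m + Y m)) n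
    ≡⟨ cong (φ 0 * (k * X n + Y n) +_) (shift-cong d λ {m} _ → mulAtFuel-affine c d (φ ∘ suc) k X Y m) ⟩
  φ 0 * (k * X n + Y n) + shift d (λ m → k * F X m + F Y m) n
    ≡⟨ cong (φ 0 * (k * X n + Y n) +_)
         (trans (shift-+ d n _ (F Y)) (cong (_+ shift d (F Y) n) (shift-* d n k (F X)))) ⟩
  φ 0 * (k * X n + Y n) + (k * shift d (F X) n + shift d (F Y) n)
    ≡⟨ regroup (φ 0) k (X n) (Y n) (shift d (F X) n) (shift d (F Y) n) ⟩
  k * (φ 0 * X n + shift d (F X) n) + (φ 0 * Y n + shift d (F Y) n) ∎
  where
  F : Series → Series
  F = mulAtFuel c d (φ ∘ suc)
  regroup : ∀ f k x y s t → f * (k * x + y) + (k * s + t) ≡ k * (f * x + s) + (f * y + t)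
  regroup = solve-∀

mulAtFuel-shift : ∀ c a b φ X n → mulAtFuel c a φ (shift b X) n ≡ shift b (mulAtFuel c a φ X) n
mulAtFuel-shift zero    a b φ X n = sym (shift-zero b n)
mulAtFuel-shift (suc c) a b φ X n = begin
  φ 0 * shift b X n + shift a (F (shift b X)) n
    ≡⟨ cong (φ 0 * shift b X n +_) (shift-cong a λ {m} _ → mulAtFuel-shift c a b (φ ∘ suc) X m) ⟩
  φ 0 * shift b X n + shift a (shift b (F X)) n
    ≡⟨ cong (φ 0 * shift b X n +_) (shift-comm a b) ⟩
  φ 0 * shift b X n + shift b (shift a (F X)) n
    ≡⟨ cong (_+ shift b (shift a (F X)) n) (shift-* b n (φ 0) X) ⟨
  shift b (λ m → φ 0 * X m) n + shift b (shift a (F X)) n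
    ≡⟨ shift-+ b n _ _ ⟨
  shift b (λ m → φ 0 * X m + shift a (F X) m) n ∎
  where
  F : Series → Series
  F = mulAtFuel c a (φ ∘ suc)

mulAt-unfold : ∀ {d} → 0 < d → ∀ φ X n →
               mulAt d φ X n ≡ φ 0 * X n + shift d (mulAt d (φ ∘ suc) X) n
mulAt-unfold d>0 φ X n = cong (φ 0 * X n +_) (shift-cong< d>0 λ {m} m<n →
  mulAtFuel-irrelevant d>0 n (suc m) (φ ∘ suc) X m<n ≤-refl)

mulAt-below : ∀ {d} φ X {n} → n < d → mulAt d φ X n ≡ φ 0 * X n
mulAt-below φ X {n} n<d = trans (cong (φ 0 * X n +_) (shift-> n<d)) (+-identityʳ _)

mulAt-zero : ∀ d {φ} X n → (∀ j → φ j ≡ 0) → mulAt d φ X n ≡ 0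
mulAt-zero d X n = mulAtFuel-zero (suc n) d X n

mulAt-δ₀ : ∀ d {φ} X n → (∀ j → φ j ≡ δ₀ j) → mulAt d φ X n ≡ X n
mulAt-δ₀ d {φ} X n φ≗δ₀ = begin
  φ 0 * X n + shift d (mulAtFuel n d (φ ∘ suc) X) n
    ≡⟨ cong₂ _+_ (cong (_* X n) (φ≗δ₀ 0))
         (shift-cong d λ {m} _ → mulAtFuel-zero n d X m (φ≗δ₀ ∘ suc)) ⟩
  1 * X n + shift d (const 0) n
    ≡⟨ cong₂ _+_ (*-identityˡ (X n)) (shift-zero d n) ⟩
  X n + 0
    ≡⟨ +-identityʳ (X n) ⟩
  X n ∎

mulAt-congφ : ∀ d {φ ψ} X n → (∀ j → φ j ≡ ψ j) → mulAt d φ X n ≡ mulAt d ψ X n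
mulAt-congφ d X n = mulAtFuel-congφ (suc n) d X n

mulAt-cong : ∀ d φ {X Y} n → (∀ {m} → m ≤ n → X m ≡ Y m) → mulAt d φ X n ≡ mulAt d φ Y n
mulAt-cong d φ n = mulAtFuel-cong (suc n) d φ n

mulAt-affine : ∀ d φ k X Y n →
               mulAt d φ (λ m → k * X m + Y m) n ≡ k * mulAt d φ X n + mulAt d φ Y n
mulAt-affine d φ k X Y n = mulAtFuel-affine (suc n) d φ k X Y n

mulAt-shift : ∀ {d} → 0 < d → ∀ b φ X n → mulAt d φ (shift b X) n ≡ shift b (mulAt d φ X) n
mulAt-shift {d} d>0 b φ X n = trans (mulAtFuel-shift (suc n) d b φ X n)
  (shift-cong b λ {m} m≤n → mulAtFuel-irrelevant d>0 (suc n) (suc m) φ X (s≤s m≤n) ≤-refl)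

mulAt-comm : ∀ {a b} → 0 < a → 0 < b → ∀ φ ψ X n →
             mulAt a φ (mulAt b ψ X) n ≡ mulAt b ψ (mulAt a φ X) n
mulAt-comm {a} {b} a>0 b>0 φ ψ X n = <-rec P step n ψ
  where
  P : ℕ → Set
  P n = ∀ ψ → mulAt a φ (mulAt b ψ X) n ≡ mulAt b ψ (mulAt a φ X) n
  step : ∀ n → (∀ {m} → m < n → P m) → P n
  step n ih ψ = begin
    mulAt a φ (mulAt b ψ X) n
      ≡⟨ mulAt-cong a φ n (λ {m} _ → mulAt-unfold b>0 ψ X m) ⟩
    mulAt a φ (λ m → ψ 0 * X m + shift b (mulAt b (ψ ∘ suc) X) m) n
      ≡⟨ mulAt-affine a φ (ψ 0) X _ n ⟩
    ψ 0 * mulAt a φ X n + mulAt a φ (shift b (mulAt b (ψ ∘ suc) X)) n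
      ≡⟨ cong (ψ 0 * mulAt a φ X n +_) (mulAt-shift a>0 b φ _ n) ⟩
    ψ 0 * mulAt a φ X n + shift b (mulAt a φ (mulAt b (ψ ∘ suc) X)) n
      ≡⟨ cong (ψ 0 * mulAt a φ X n +_) (shift-cong< b>0 λ m<n → ih m<n (ψ ∘ suc)) ⟩
    ψ 0 * mulAt a φ X n + shift b (mulAt b (ψ ∘ suc) (mulAt a φ X)) n
      ≡⟨ mulAt-unfold b>0 ψ (mulAt a φ X) n ⟨
    mulAt b ψ (mulAt a φ X) n ∎

mulAt-two-terms : ∀ {d} → 0 < d → ∀ {h} → (∀ j → h (2 + j) ≡ 0) → ∀ Z n →
               mulAt d h Z n ≡ h 0 * Z n + h 1 * shift d Z n
mulAt-two-terms {d} d>0 {h} h≡0 Z n = begin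
  mulAt d h Z n                                ≡⟨ mulAt-unfold d>0 h Z n ⟩
  h 0 * Z n + shift d (mulAt d (h ∘ suc) Z) n  ≡⟨ cong (h 0 * Z n +_) (shift-cong d λ {m} _ → tail m) ⟩
  h 0 * Z n + shift d (λ m → h 1 * Z m) n      ≡⟨ cong (h 0 * Z n +_) (shift-* d n (h 1) Z) ⟩
  h 0 * Z n + h 1 * shift d Z n                ∎
  where
  tail : ∀ m → mulAt d (h ∘ suc) Z m ≡ h 1 * Z m
  tail m = begin
    mulAt d (h ∘ suc) Z m
      ≡⟨ mulAt-unfold d>0 (h ∘ suc) Z m ⟩
    h 1 * Z m + shift d (mulAt d (h ∘ suc ∘ suc) Z) m
      ≡⟨ cong (h 1 * Z m +_) (trans (shift-cong d λ {k} _ → mulAt-zero d Z k h≡0) (shift-zero d m)) ⟩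
    h 1 * Z m + 0
      ≡⟨ +-identityʳ _ ⟩
    h 1 * Z m ∎

-- Doubling and dilation (q ↦ q²)

double : ℕ → ℕ
double zero    = zero
double (suc k) = suc (suc (double k))

data EvenOdd : ℕ → Set where
  even : ∀ i → EvenOdd (double i)
  odd  : ∀ i → EvenOdd (suc (double i))

evenOdd : ∀ n → EvenOdd n
evenOdd zero = even zero
evenOdd (suc n) with evenOdd n
... | even i = odd i
... | odd  i = even (suc i)

double-pos : ∀ {d} → 0 < d → 0 < double d
double-pos {suc d} _ = s≤s z≤n

double-≡-+ : ∀ k → double k ≡ k + k
double-≡-+ zero    = refl
double-≡-+ (suc k) = cong suc (trans (cong suc (double-≡-+ k)) (sym (+-suc k k)))

double-mono-≤ : ∀ {a b} → a ≤ b → double a ≤ double b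
double-mono-≤ z≤n       = z≤n
double-mono-≤ (s≤s a≤b) = s≤s (s≤s (double-mono-≤ a≤b))

suc-double-< : ∀ {a b} → a < b → suc (double a) < double b
suc-double-< {zero}  {suc b} _         = s≤s (s≤s z≤n)
suc-double-< {suc a} {suc b} (s≤s a<b) = s≤s (s≤s (suc-double-< a<b))

double-∸ : ∀ i d → double i ∸ double d ≡ double (i ∸ d)
double-∸ zero    zero    = refl
double-∸ zero    (suc d) = refl
double-∸ (suc i) zero    = refl
double-∸ (suc i) (suc d) = double-∸ i d

suc-double-∸ : ∀ {i d} → d ≤ i → suc (double i) ∸ double d ≡ suc (double (i ∸ d))
suc-double-∸ {i}     {zero}  _         = refl
suc-double-∸ {suc i} {suc d} (s≤s d≤i) = suc-double-∸ d≤i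

≤-double : ∀ i → i ≤ double i
≤-double zero    = z≤n
≤-double (suc i) = s≤s (m≤n⇒m≤1+n (≤-double i))

double≤suc⇒< : ∀ i m → double i ≤ suc m → i < suc m
double≤suc⇒< zero    m _          = s≤s z≤n
double≤suc⇒< (suc i) m (s≤s 2i<m) = s≤s (≤-trans (s≤s (≤-double i)) 2i<m)

-- spread z Y puts Y i at index 2i and z at odd indices; dilate X is X(q²).
spread : {A : Set} → A → (ℕ → A) → ℕ → A
spread z Y zero                = Y zero
spread z Y (suc zero)          = z
spread z Y (suc (suc n))       = spread z (Y ∘ suc) n

spread-double : {A : Set} (z : A) (Y : ℕ → A) (i : ℕ) → spread z Y (double i) ≡ Y i
spread-double z Y zero    = refl
spread-double z Y (suc i) = spread-double z (Y ∘ suc) i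

spread-odd : {A : Set} (z : A) (Y : ℕ → A) (i : ℕ) → spread z Y (suc (double i)) ≡ z
spread-odd z Y zero    = refl
spread-odd z Y (suc i) = spread-odd z (Y ∘ suc) i

dilate : Series → Series
dilate = spread 0

dilate-cong : ∀ {X Y : Series} n → (∀ i → double i ≤ n → X i ≡ Y i) → dilate X n ≡ dilate Y n
dilate-cong n eq with evenOdd n
... | even i = trans (spread-double 0 _ i) (trans (eq i ≤-refl) (sym (spread-double 0 _ i)))
... | odd  i = trans (spread-odd 0 _ i) (sym (spread-odd 0 _ i))

dilate-affine : ∀ k (X Y : Series) n → dilate (λ m → k * X m + Y m) n ≡ k * dilate X n + dilate Y n
dilate-affine k X Y n with evenOdd n
... | even i = trans (spread-double 0 _ i)
                     (sym (cong₂ (λ x y → k * x + y) (spread-double 0 X i) (spread-double 0 Y i)))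
... | odd  i = trans (spread-odd 0 _ i) (sym (begin
  k * dilate X (suc (double i)) + dilate Y (suc (double i))
    ≡⟨ cong₂ (λ x y → k * x + y) (spread-odd 0 X i) (spread-odd 0 Y i) ⟩
  k * 0 + 0
    ≡⟨ trans (+-identityʳ (k * 0)) (*-zeroʳ k) ⟩
  0 ∎))

dilate-δ₀ : ∀ n → dilate δ₀ n ≡ δ₀ n
dilate-δ₀ n with evenOdd n
... | even zero    = refl
... | even (suc i) = spread-double 0 δ₀ (suc i)
... | odd  i       = spread-odd 0 δ₀ i

shift-dilate : ∀ d (Z : Series) n → shift (double d) (dilate Z) n ≡ dilate (shift d Z) n
shift-dilate d Z n with evenOdd n
... | even i with d ≤? i
...   | yes d≤i = begin
  shift (double d) (dilate Z) (double i)  ≡⟨ shift-≤ (double-mono-≤ d≤i) ⟩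
  dilate Z (double i ∸ double d)          ≡⟨ cong (dilate Z) (double-∸ i d) ⟩
  dilate Z (double (i ∸ d))               ≡⟨ spread-double 0 Z (i ∸ d) ⟩
  Z (i ∸ d)                               ≡⟨ shift-≤ d≤i ⟨
  shift d Z i                             ≡⟨ spread-double 0 (shift d Z) i ⟨
  dilate (shift d Z) (double i)           ∎
...   | no d≰i = trans (shift-> (<⇒≤ (suc-double-< (≰⇒> d≰i))))
                   (sym (trans (spread-double 0 (shift d Z) i) (shift-> (≰⇒> d≰i))))
shift-dilate d Z n | odd i with d ≤? i
...   | yes d≤i = begin
  shift (double d) (dilate Z) (suc (double i)) ≡⟨ shift-≤ (m≤n⇒m≤1+n (double-mono-≤ d≤i)) ⟩
  dilate Z (suc (double i) ∸ double d)         ≡⟨ cong (dilate Z) (suc-double-∸ d≤i) ⟩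
  dilate Z (suc (double (i ∸ d)))              ≡⟨ spread-odd 0 Z (i ∸ d) ⟩
  0                                            ≡⟨ spread-odd 0 (shift d Z) i ⟨
  dilate (shift d Z) (suc (double i))          ∎
...   | no d≰i = trans (shift-> (suc-double-< (≰⇒> d≰i))) (sym (spread-odd 0 (shift d Z) i))

mulAt-dilate : ∀ {d} → 0 < d → ∀ φ Y n → mulAt (double d) φ (dilate Y) n ≡ dilate (mulAt d φ Y) n
mulAt-dilate {d} d>0 φ Y n = <-rec P step n φ
  where
  P : ℕ → Set
  P n = ∀ φ → mulAt (double d) φ (dilate Y) n ≡ dilate (mulAt d φ Y) n
  step : ∀ n → (∀ {m} → m < n → P m) → P n
  step n ih φ = begin
    mulAt (double d) φ (dilate Y) n
      ≡⟨ mulAt-unfold (double-pos d>0) φ (dilate Y) n ⟩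
    φ 0 * dilate Y n + shift (double d) (mulAt (double d) (φ ∘ suc) (dilate Y)) n
      ≡⟨ cong (φ 0 * dilate Y n +_) (shift-cong< (double-pos d>0) λ m<n → ih m<n (φ ∘ suc)) ⟩
    φ 0 * dilate Y n + shift (double d) (dilate (mulAt d (φ ∘ suc) Y)) n
      ≡⟨ cong (φ 0 * dilate Y n +_) (shift-dilate d _ n) ⟩
    φ 0 * dilate Y n + dilate (shift d (mulAt d (φ ∘ suc) Y)) n
      ≡⟨ dilate-affine (φ 0) Y _ n ⟨
    dilate (λ m → φ 0 * Y m + shift d (mulAt d (φ ∘ suc) Y) m) n
      ≡⟨ dilate-cong n (λ i _ → mulAt-unfold d>0 φ Y i) ⟨
    dilate (mulAt d φ Y) n ∎

-- For 2-periodic g, Σⱼ g j q^(jd) = (g 0 + g 1 q^d) / (1 − q^(2d)): both sides solve Z = A + q^(2d) Z.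
mulAt-periodic : ∀ {d} → 0 < d → ∀ {g h} → (∀ j → g (2 + j) ≡ g j) →
  h 0 ≡ g 0 → h 1 ≡ g 1 → (∀ j → h (2 + j) ≡ 0) →
  ∀ Y n → mulAt d g Y n ≡ mulAt d h (mulAt (double d) (const 1) Y) n
mulAt-periodic {d} d>0 {g} {h} periodic h0 h1 h≡0 Y =
  shift-fixpoint-unique (double-pos d>0) lhs rhs
  where
  A S Z₂ : Series
  A n = g 0 * Y n + g 1 * shift d Y n
  S = mulAt (double d) (const 1) Y
  Z₂ = mulAt d h S

  lhs : ∀ n → mulAt d g Y n ≡ A n + shift (double d) (mulAt d g Y) n
  lhs n = begin
    mulAt d g Y n
      ≡⟨ mulAt-unfold d>0 g Y n ⟩
    g 0 * Y n + shift d (mulAt d (g ∘ suc) Y) n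
      ≡⟨ cong (g 0 * Y n +_) (shift-cong d λ {m} _ → trans (mulAt-unfold d>0 (g ∘ suc) Y m)
           (cong (g 1 * Y m +_) (shift-cong d λ {k} _ → mulAt-congφ d Y k periodic))) ⟩
    g 0 * Y n + shift d (λ m → g 1 * Y m + shift d (mulAt d g Y) m) n
      ≡⟨ cong (g 0 * Y n +_) (trans (shift-+ d n _ _) (cong₂ _+_ (shift-* d n (g 1) Y)
           (trans (shift-shift d d) (cong (λ e → shift e (mulAt d g Y) n) (sym (double-≡-+ d)))))) ⟩
    g 0 * Y n + (g 1 * shift d Y n + shift (double d) (mulAt d g Y) n)
      ≡⟨ +-assoc (g 0 * Y n) _ _ ⟨
    A n + shift (double d) (mulAt d g Y) n ∎

  S-eq : ∀ m → S m ≡ Y m + shift (double d) S m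
  S-eq m = trans (mulAt-unfold (double-pos d>0) (const 1) Y m)
                 (cong (_+ shift (double d) S m) (*-identityˡ (Y m)))

  Z₂-eq : ∀ m → Z₂ m ≡ g 0 * S m + g 1 * shift d S m
  Z₂-eq m = trans (mulAt-two-terms d>0 {h} h≡0 S m) (cong₂ (λ x y → x * S m + y * shift d S m) h0 h1)

  regroup : ∀ a b y s t u → a * (y + s) + b * (t + u) ≡ (a * y + b * t) + (a * s + b * u)
  regroup = solve-∀

  rhs : ∀ n → Z₂ n ≡ A n + shift (double d) Z₂ n
  rhs n = begin
    Z₂ n
      ≡⟨ Z₂-eq n ⟩
    g 0 * S n + g 1 * shift d S n
      ≡⟨ cong₂ (λ x y → g 0 * x + g 1 * y) (S-eq n) (shift-cong d λ {m} _ → S-eq m) ⟩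
    g 0 * (Y n + shift (double d) S n) + g 1 * shift d (λ m → Y m + shift (double d) S m) n
      ≡⟨ cong (λ x → g 0 * (Y n + shift (double d) S n) + g 1 * x)
           (trans (shift-+ d n Y _) (cong (shift d Y n +_) (shift-comm d (double d)))) ⟩
    g 0 * (Y n + shift (double d) S n) + g 1 * (shift d Y n + shift (double d) (shift d S) n)
      ≡⟨ regroup (g 0) (g 1) (Y n) _ _ _ ⟩
    A n + (g 0 * shift (double d) S n + g 1 * shift (double d) (shift d S) n)
      ≡⟨ cong (A n +_) (cong₂ _+_ (shift-* (double d) n (g 0) S) (shift-* (double d) n (g 1) (shift d S))) ⟨
    A n + (shift (double d) (λ m → g 0 * S m) n + shift (double d) (λ m → g 1 * shift d S m) n)
      ≡⟨ cong (A n +_) (shift-+ (double d) n _ _) ⟨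
    A n + shift (double d) (λ m → g 0 * S m + g 1 * shift d S m) n
      ≡⟨ cong (A n +_) (shift-cong (double d) λ {m} _ → Z₂-eq m) ⟨
    A n + shift (double d) Z₂ n ∎

oddᵇ : ℕ → Bool
oddᵇ zero          = false
oddᵇ (suc zero)    = true
oddᵇ (suc (suc n)) = oddᵇ n

oddᵇ-double : ∀ i → oddᵇ (double i) ≡ false
oddᵇ-double zero    = refl
oddᵇ-double (suc i) = oddᵇ-double i

oddᵇ-suc-double : ∀ i → oddᵇ (suc (double i)) ≡ true
oddᵇ-suc-double zero    = refl
oddᵇ-suc-double (suc i) = oddᵇ-suc-double i

isOdd≡oddᵇ : ∀ n → isOdd n ≡ oddᵇ n
isOdd≡oddᵇ zero          = refl
isOdd≡oddᵇ (suc zero)    = refl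
isOdd≡oddᵇ (suc (suc n)) = isOdd≡oddᵇ n

parity-≢ : ∀ {a b} → oddᵇ a ≡ false → oddᵇ b ≡ true → a ≢ b
parity-≢ a-even b-odd refl with trans (sym a-even) b-odd
... | ()

bool-cases : ∀ {ℓ} {P : Set ℓ} b → (b ≡ true → P) → (b ≡ false → P) → P
bool-cases true  t f = t refl
bool-cases false t f = f refl

≤ᵇ-true : ∀ {m n} → m ≤ n → (m ≤ᵇ n) ≡ true
≤ᵇ-true {m} {n} = dec-true (m ≤? n)

≤ᵇ-false : ∀ {m n} → n < m → (m ≤ᵇ n) ≡ false
≤ᵇ-false {m} {n} n<m = dec-false (m ≤? n) (<⇒≱ n<m)

≡ᵇ-true : ∀ {m n} → m ≡ n → (m ≡ᵇ n) ≡ true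
≡ᵇ-true {m} {n} = dec-true (m ≟ n)

≡ᵇ-false : ∀ {m n} → m ≢ n → (m ≡ᵇ n) ≡ false
≡ᵇ-false {m} {n} = dec-false (m ≟ n)

-- Products over part sizes

Family : Set
Family = ℕ → ℕ → ℕ

-- mulUpTo M F X = X · ∏_{d = 1..M} Σⱼ F d j q^(j·d)
mulUpTo : ℕ → Family → Series → Series
mulUpTo zero    F X = X
mulUpTo (suc M) F X = mulAt (suc M) (F (suc M)) (mulUpTo M F X)

mulUpTo-cong : ∀ M F {X Y} n → (∀ {m} → m ≤ n → X m ≡ Y m) → mulUpTo M F X n ≡ mulUpTo M F Y n
mulUpTo-cong zero    F n eq = eq ≤-refl
mulUpTo-cong (suc M) F n eq =
  mulAt-cong (suc M) (F (suc M)) n λ m≤n → mulUpTo-cong M F _ λ k≤m → eq (≤-trans k≤m m≤n)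

mulUpTo-congF : ∀ M {F G} X n → (∀ {d} → 0 < d → d ≤ M → ∀ j → F d j ≡ G d j) →
                mulUpTo M F X n ≡ mulUpTo M G X n
mulUpTo-congF zero          X n eq = refl
mulUpTo-congF (suc M) {G = G} X n eq =
  trans (mulAt-congφ (suc M) _ n (eq (s≤s z≤n) ≤-refl))
        (mulAt-cong (suc M) (G (suc M)) n λ {m} _ →
           mulUpTo-congF M X m λ d>0 d≤M → eq d>0 (m≤n⇒m≤1+n d≤M))

mulUpTo-at-0 : ∀ M F X → (∀ d → F d 0 ≡ 1) → mulUpTo M F X 0 ≡ X 0
mulUpTo-at-0 zero    F X F0≡1 = refl
mulUpTo-at-0 (suc M) F X F0≡1 = begin
  mulAt (suc M) (F (suc M)) (mulUpTo M F X) 0  ≡⟨ mulAt-below {suc M} (F (suc M)) (mulUpTo M F X) (s≤s z≤n) ⟩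
  F (suc M) 0 * mulUpTo M F X 0                ≡⟨ cong₂ _*_ (F0≡1 (suc M)) (mulUpTo-at-0 M F X F0≡1) ⟩
  1 * X 0                                      ≡⟨ *-identityˡ (X 0) ⟩
  X 0                                          ∎

mulUpTo-truncate : ∀ k M F X {n} → n ≤ M → (∀ d → M < d → F d 0 ≡ 1) →
                   mulUpTo (k + M) F X n ≡ mulUpTo M F X n
mulUpTo-truncate zero    M F X n≤M F0≡1 = refl
mulUpTo-truncate (suc k) M F X {n} n≤M F0≡1 = begin
  mulAt (suc (k + M)) (F (suc (k + M))) (mulUpTo (k + M) F X) n
    ≡⟨ mulAt-below (F (suc (k + M))) (mulUpTo (k + M) F X) (s≤s (≤-trans n≤M (m≤n+m M k))) ⟩
  F (suc (k + M)) 0 * mulUpTo (k + M) F X n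
    ≡⟨ cong (_* mulUpTo (k + M) F X n) (F0≡1 _ (s≤s (m≤n+m M k))) ⟩
  1 * mulUpTo (k + M) F X n
    ≡⟨ *-identityˡ _ ⟩
  mulUpTo (k + M) F X n
    ≡⟨ mulUpTo-truncate k M F X n≤M F0≡1 ⟩
  mulUpTo M F X n ∎

mulUpTo-truncate-double : ∀ M F X {n} → n ≤ M → (∀ d → M < d → F d 0 ≡ 1) →
                          mulUpTo (double M) F X n ≡ mulUpTo M F X n
mulUpTo-truncate-double M F X n≤M F0≡1 =
  trans (cong (λ K → mulUpTo K F X _) (double-≡-+ M)) (mulUpTo-truncate M M F X n≤M F0≡1)

mulAt-mulUpTo : ∀ {a} → 0 < a → ∀ φ M F X n → mulAt a φ (mulUpTo M F X) n ≡ mulUpTo M F (mulAt a φ X) n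
mulAt-mulUpTo a>0 φ zero    F X n = refl
mulAt-mulUpTo a>0 φ (suc M) F X n =
  trans (mulAt-comm a>0 (s≤s z≤n) φ (F (suc M)) _ n)
        (mulAt-cong (suc M) (F (suc M)) n λ {m} _ → mulAt-mulUpTo a>0 φ M F X m)

mulUpTo-dilate : ∀ K G Y n → mulUpTo (double K) (spread δ₀ G) (dilate Y) n ≡ dilate (mulUpTo K G Y) n
mulUpTo-dilate zero    G Y n = refl
mulUpTo-dilate (suc K) G Y n = begin
  mulAt (double (suc K)) (spread δ₀ G (double (suc K)))
    (mulAt (suc (double K)) (spread δ₀ G (suc (double K))) (mulUpTo (double K) (spread δ₀ G) (dilate Y))) n
    ≡⟨ mulAt-congφ (double (suc K)) _ n (λ j → cong (λ φ → φ j) (spread-double δ₀ G (suc K))) ⟩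
  mulAt (double (suc K)) (G (suc K))
    (mulAt (suc (double K)) (spread δ₀ G (suc (double K))) (mulUpTo (double K) (spread δ₀ G) (dilate Y))) n
    ≡⟨ mulAt-cong (double (suc K)) (G (suc K)) n (λ {m} _ →
         trans (mulAt-δ₀ (suc (double K)) _ m (λ j → cong (λ φ → φ j) (spread-odd δ₀ G K)))
               (mulUpTo-dilate K G Y m)) ⟩
  mulAt (double (suc K)) (G (suc K)) (dilate (mulUpTo K G Y)) n
    ≡⟨ mulAt-dilate (s≤s z≤n) (G (suc K)) (mulUpTo K G Y) n ⟩
  dilate (mulUpTo (suc K) G Y) n ∎

oddPart evenPart : Family → Family
oddPart  F d = if oddᵇ d then F d else δ₀
evenPart F d = if oddᵇ d then δ₀ else F d

module _ (F : Family) (d : ℕ) where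

  oddPart-odd : oddᵇ d ≡ true → ∀ j → oddPart F d j ≡ F d j
  oddPart-odd d-odd j rewrite d-odd = refl

  oddPart-even : oddᵇ d ≡ false → ∀ j → oddPart F d j ≡ δ₀ j
  oddPart-even d-even j rewrite d-even = refl

  evenPart-odd : oddᵇ d ≡ true → ∀ j → evenPart F d j ≡ δ₀ j
  evenPart-odd d-odd j rewrite d-odd = refl

  evenPart-even : oddᵇ d ≡ false → ∀ j → evenPart F d j ≡ F d j
  evenPart-even d-even j rewrite d-even = refl

mulUpTo-split : ∀ M F X n → mulUpTo M F X n ≡ mulUpTo M (oddPart F) (mulUpTo M (evenPart F) X) n
mulUpTo-split zero    F X n = refl
mulUpTo-split (suc M) F X n = bool-cases (oddᵇ d) odd-step even-step
  where
  d = suc M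
  oF = oddPart F
  eF = evenPart F
  IH : mulAt d (F d) (mulUpTo M F X) n ≡ mulAt d (F d) (mulUpTo M oF (mulUpTo M eF X)) n
  IH = mulAt-cong d (F d) n (λ {m} _ → mulUpTo-split M F X m)

  odd-step : oddᵇ d ≡ true → _
  odd-step d-odd = begin
    mulAt d (F d) (mulUpTo M F X) n
      ≡⟨ IH ⟩
    mulAt d (F d) (mulUpTo M oF (mulUpTo M eF X)) n
      ≡⟨ mulAt-congφ d _ n (oddPart-odd F d d-odd) ⟨
    mulAt d (oF d) (mulUpTo M oF (mulUpTo M eF X)) n
      ≡⟨ mulAt-cong d (oF d) n (λ {m} _ → mulUpTo-cong M oF m λ {k} _ →
           sym (mulAt-δ₀ d _ k (evenPart-odd F d d-odd))) ⟩
    mulAt d (oF d) (mulUpTo M oF (mulAt d (eF d) (mulUpTo M eF X))) n ∎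

  even-step : oddᵇ d ≡ false → _
  even-step d-even = begin
    mulAt d (F d) (mulUpTo M F X) n
      ≡⟨ IH ⟩
    mulAt d (F d) (mulUpTo M oF (mulUpTo M eF X)) n
      ≡⟨ mulAt-mulUpTo (s≤s z≤n) (F d) M oF _ n ⟩
    mulUpTo M oF (mulAt d (F d) (mulUpTo M eF X)) n
      ≡⟨ mulUpTo-cong M oF n (λ {m} _ → mulAt-congφ d _ m (evenPart-even F d d-even)) ⟨
    mulUpTo M oF (mulAt d (eF d) (mulUpTo M eF X)) n
      ≡⟨ mulAt-δ₀ d _ n (oddPart-even F d d-even) ⟨
    mulAt d (oF d) (mulUpTo M oF (mulAt d (eF d) (mulUpTo M eF X))) n ∎

-- Euler's identity and its weighted form

upToOne : ℕ → ℕ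
upToOne zero          = 1
upToOne (suc zero)    = 1
upToOne (suc (suc _)) = 0

mulAt-geometric : ∀ {d} → 0 < d → ∀ Y n →
                  mulAt d (const 1) Y n ≡ mulAt d upToOne (mulAt (double d) (const 1) Y) n
mulAt-geometric d>0 = mulAt-periodic d>0 {const 1} {upToOne} (λ _ → refl) refl refl (λ _ → refl)

distinctParts oddParts : Family
distinctParts _ = upToOne
oddParts        = oddPart (λ _ → const 1)

distinctGF oddGF : ℕ → Series
distinctGF L = mulUpTo L distinctParts δ₀
oddGF      L = mulUpTo L oddParts δ₀

mulUpTo-evens-dilate : ∀ K {F} → (∀ d → 0 < d → ∀ j → F (double d) j ≡ upToOne j) → ∀ n →
  mulUpTo (double K) F δ₀ n ≡ mulUpTo (double K) (oddPart F) (dilate (distinctGF K)) n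
mulUpTo-evens-dilate K {F} F-even n = trans (mulUpTo-split (double K) F δ₀ n)
  (mulUpTo-cong (double K) (oddPart F) n λ {m} _ → begin
    mulUpTo (double K) (evenPart F) δ₀ m
      ≡⟨ mulUpTo-cong (double K) _ m (λ {k} _ → dilate-δ₀ k) ⟨
    mulUpTo (double K) (evenPart F) (dilate δ₀) m
      ≡⟨ mulUpTo-congF (double K) _ m evenPart≗spread ⟩
    mulUpTo (double K) (spread δ₀ distinctParts) (dilate δ₀) m
      ≡⟨ mulUpTo-dilate K distinctParts δ₀ m ⟩
    dilate (distinctGF K) m ∎)
  where
  evenPart≗spread : ∀ {d} → 0 < d → d ≤ double K → ∀ j → evenPart F d j ≡ spread δ₀ distinctParts d j
  evenPart≗spread {d} d>0 _ j with evenOdd d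
  evenPart≗spread () _ j | even zero
  ... | even (suc i) = trans (evenPart-even F (double (suc i)) (oddᵇ-double (suc i)) j)
    (trans (F-even (suc i) (s≤s z≤n) j) (sym (cong (λ φ → φ j) (spread-double δ₀ distinctParts (suc i)))))
  ... | odd i = trans (evenPart-odd F (suc (double i)) (oddᵇ-suc-double i) j)
    (sym (cong (λ φ → φ j) (spread-odd δ₀ distinctParts i)))

mulUpTo-factor : ∀ {F G E : Family} →
  (∀ d → 0 < d → ∀ Y m → mulAt d (F d) Y m ≡ mulAt d (G d) (mulAt (double d) (E d) Y) m) →
  ∀ L X n → mulUpTo L F X n ≡ mulUpTo L G (mulUpTo (double L) (spread δ₀ E) X) n
mulUpTo-factor         hyp zero    X n = refl
mulUpTo-factor {F} {G} {E} hyp (suc L) X n = begin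
  mulAt d (F d) (mulUpTo L F X) n
    ≡⟨ hyp d (s≤s z≤n) _ n ⟩
  mulAt d (G d) (mulAt (double d) (E d) (mulUpTo L F X)) n
    ≡⟨ mulAt-cong d (G d) n (λ {m} _ → mulAt-cong (double d) (E d) m λ {k} _ → mulUpTo-factor hyp L X k) ⟩
  mulAt d (G d) (mulAt (double d) (E d) (mulUpTo L G Z)) n
    ≡⟨ mulAt-cong d (G d) n (λ {m} _ → mulAt-mulUpTo (s≤s z≤n) (E d) L G Z m) ⟩
  mulAt d (G d) (mulUpTo L G (mulAt (double d) (E d) Z)) n
    ≡⟨ mulAt-cong d (G d) n (λ {m} _ → mulUpTo-cong L G m λ {k} _ → new-layers k) ⟩
  mulUpTo d G (mulUpTo (double d) E′ X) n ∎
  where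
  d = suc L
  E′ = spread δ₀ E
  Z = mulUpTo (double L) E′ X
  new-layers : ∀ k → mulAt (double d) (E d) Z k ≡
                     mulAt (double d) (E′ (double d)) (mulAt (suc (double L)) (E′ (suc (double L))) Z) k
  new-layers k = sym (trans
    (mulAt-congφ (double d) _ k (λ j → cong (λ φ → φ j) (spread-double δ₀ E d)))
    (mulAt-cong (double d) (E d) k λ {i} _ →
      mulAt-δ₀ (suc (double L)) Z i (λ j → cong (λ φ → φ j) (spread-odd δ₀ E L))))

-- ∏ F = ∏_{odd d} F d · ∏_d (1 + q^(2d)) = ∏_{odd d} F d · ∏_{odd d} 1/(1 − q^(2d)) = ∏ G,
-- the middle step being Euler's identity in q², needed only up to degree n/2.
mulUpTo-glaisher : ∀ L {F G : Family} →
  (∀ d → 0 < d → ∀ j → F (double d) j ≡ upToOne j) →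
  (∀ d → L < d → F d 0 ≡ 1) →
  (∀ d → 0 < d → oddᵇ d ≡ true → ∀ Y m →
     mulAt d (G d) Y m ≡ mulAt d (F d) (mulAt (double d) (const 1) Y) m) →
  (∀ d → oddᵇ d ≡ false → ∀ j → G d j ≡ δ₀ j) →
  ∀ n → n ≤ L → (∀ i → double i ≤ n → distinctGF L i ≡ oddGF L i) →
  mulUpTo L F δ₀ n ≡ mulUpTo L G δ₀ n
mulUpTo-glaisher L {F} {G} F-even F-large G-odd G-even n n≤L euler-below = begin
  mulUpTo L F δ₀ n
    ≡⟨ mulUpTo-truncate-double L F δ₀ n≤L F-large ⟨
  mulUpTo (double L) F δ₀ n
    ≡⟨ mulUpTo-evens-dilate L F-even n ⟩
  mulUpTo (double L) (oddPart F) (dilate (distinctGF L)) n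
    ≡⟨ mulUpTo-truncate-double L (oddPart F) _ n≤L oddPart-large ⟩
  mulUpTo L (oddPart F) (dilate (distinctGF L)) n
    ≡⟨ mulUpTo-cong L (oddPart F) n (λ {m} m≤n →
         dilate-cong m λ i 2i≤m → euler-below i (≤-trans 2i≤m m≤n)) ⟩
  mulUpTo L (oddPart F) (dilate (oddGF L)) n
    ≡⟨ mulUpTo-cong L (oddPart F) n (λ {m} _ → trans (sym (mulUpTo-dilate L oddParts δ₀ m))
         (mulUpTo-cong (double L) _ m λ {k} _ → dilate-δ₀ k)) ⟩
  mulUpTo L (oddPart F) (mulUpTo (double L) (spread δ₀ oddParts) δ₀) n
    ≡⟨ mulUpTo-factor factor L δ₀ n ⟨
  mulUpTo L G δ₀ n ∎
  where
  oddPart-large : ∀ d → L < d → oddPart F d 0 ≡ 1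
  oddPart-large d L<d = bool-cases (oddᵇ d)
    (λ d-odd → trans (oddPart-odd F d d-odd 0) (F-large d L<d))
    (λ d-even → oddPart-even F d d-even 0)

  factor : ∀ d → 0 < d → ∀ Y m →
           mulAt d (G d) Y m ≡ mulAt d (oddPart F d) (mulAt (double d) (oddParts d) Y) m
  factor d d>0 Y m = bool-cases (oddᵇ d)
    (λ d-odd → begin
       mulAt d (G d) Y m
         ≡⟨ G-odd d d>0 d-odd Y m ⟩
       mulAt d (F d) (mulAt (double d) (const 1) Y) m
         ≡⟨ mulAt-congφ d _ m (oddPart-odd F d d-odd) ⟨
       mulAt d (oddPart F d) (mulAt (double d) (const 1) Y) m
         ≡⟨ mulAt-cong d (oddPart F d) m (λ {k} _ → mulAt-congφ (double d) Y k (oddPart-odd _ d d-odd)) ⟨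
       mulAt d (oddPart F d) (mulAt (double d) (oddParts d) Y) m ∎)
    (λ d-even → begin
       mulAt d (G d) Y m
         ≡⟨ mulAt-δ₀ d Y m (G-even d d-even) ⟩
       Y m
         ≡⟨ mulAt-δ₀ (double d) Y m (oddPart-even _ d d-even) ⟨
       mulAt (double d) (oddParts d) Y m
         ≡⟨ mulAt-δ₀ d _ m (oddPart-even F d d-even) ⟨
       mulAt d (oddPart F d) (mulAt (double d) (oddParts d) Y) m ∎)

euler : ∀ L n → n ≤ L → distinctGF L n ≡ oddGF L n
euler L = <-rec (λ n → n ≤ L → distinctGF L n ≡ oddGF L n) step
  where
  oddParts-0 : ∀ d → oddParts d 0 ≡ 1
  oddParts-0 d = bool-cases (oddᵇ d) (λ d-odd → oddPart-odd _ d d-odd 0) (λ d-even → oddPart-even _ d d-even 0)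

  odd-geometric : ∀ d → 0 < d → oddᵇ d ≡ true → ∀ Y m →
                  mulAt d (oddParts d) Y m ≡ mulAt d upToOne (mulAt (double d) (const 1) Y) m
  odd-geometric d d>0 d-odd Y m = trans (mulAt-congφ d Y m (oddPart-odd _ d d-odd))
    (mulAt-geometric d>0 Y m)

  step : ∀ n → (∀ {m} → m < n → m ≤ L → distinctGF L m ≡ oddGF L m) →
         n ≤ L → distinctGF L n ≡ oddGF L n
  step zero    _  _   =
    trans (mulUpTo-at-0 L distinctParts δ₀ λ _ → refl) (sym (mulUpTo-at-0 L oddParts δ₀ oddParts-0))
  step (suc n) ih n<L = mulUpTo-glaisher L (λ _ _ _ → refl) (λ _ _ → refl) odd-geometric
    (λ d d-even → oddPart-even _ d d-even) (suc n) n<L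
    (λ i 2i≤n → ih (double≤suc⇒< i n 2i≤n) (≤-trans (<⇒≤ (double≤suc⇒< i n 2i≤n)) n<L))

-- ∏ distinctW and ∏ oddW generate Σ_{𝒟(n)} [1 ∈ λ][p ∈ λ] and Σ_{𝒪(n)} (m₁ mod 2)(m_p mod 2).
module WeightedGlaisher (p : ℕ) (1<p : 1 < p) (p-odd : oddᵇ p ≡ true) where

  special : ℕ → Bool
  special d = (d ≡ᵇ 1) ∨ (d ≡ᵇ p)

  exactlyOne : ℕ → ℕ
  exactlyOne zero          = 0
  exactlyOne (suc zero)    = 1
  exactlyOne (suc (suc _)) = 0

  distinctW oddW : Family
  distinctW d = if special d then exactlyOne else upToOne
  oddW      d = if oddᵇ d then (if special d then (_% 2) else const 1) else δ₀

  special-false : ∀ {d} → d ≢ 1 → d ≢ p → special d ≡ false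
  special-false d≢1 d≢p = cong₂ _∨_ (≡ᵇ-false d≢1) (≡ᵇ-false d≢p)

  distinctW-double : ∀ d → 0 < d → ∀ j → distinctW (double d) j ≡ upToOne j
  distinctW-double d _ j = cong (λ b → (if b then exactlyOne else upToOne) j)
    (special-false {double d} (parity-≢ (oddᵇ-double d) refl) (parity-≢ (oddᵇ-double d) p-odd))

  distinctW-large : ∀ {L} → p ≤ L → ∀ d → L < d → distinctW d 0 ≡ 1
  distinctW-large p≤L d L<d = cong (λ b → (if b then exactlyOne else upToOne) 0)
    (special-false (>⇒≢ (<-trans 1<p p<d)) (>⇒≢ p<d))
    where p<d = ≤-<-trans p≤L L<d

  oddW-even : ∀ d → oddᵇ d ≡ false → ∀ j → oddW d j ≡ δ₀ j
  oddW-even d d-even j rewrite d-even = refl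

  oddW-split : ∀ d → 0 < d → oddᵇ d ≡ true → ∀ Y m →
               mulAt d (oddW d) Y m ≡ mulAt d (distinctW d) (mulAt (double d) (const 1) Y) m
  oddW-split d d>0 d-odd Y m = bool-cases (special d) special-split ordinary-split
    where
    special-split : special d ≡ true → _
    special-split sp = begin
      mulAt d (oddW d) Y m
        ≡⟨ mulAt-congφ d Y m oddW≗parity ⟩
      mulAt d (_% 2) Y m
        ≡⟨ mulAt-periodic d>0 {_% 2} {exactlyOne} mod2-periodic refl refl (λ _ → refl) Y m ⟩
      mulAt d exactlyOne (mulAt (double d) (const 1) Y) m
        ≡⟨ mulAt-congφ d _ m distinctW≗exactlyOne ⟨
      mulAt d (distinctW d) (mulAt (double d) (const 1) Y) m ∎
      where
      oddW≗parity : ∀ j → oddW d j ≡ j % 2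
      oddW≗parity j = cong₂ (λ a b → (if a then (if b then (_% 2) else const 1) else δ₀) j) d-odd sp
      distinctW≗exactlyOne : ∀ j → distinctW d j ≡ exactlyOne j
      distinctW≗exactlyOne j = cong (λ b → (if b then exactlyOne else upToOne) j) sp
      mod2-periodic : ∀ j → (2 + j) % 2 ≡ j % 2
      mod2-periodic j = trans (cong (_% 2) (+-comm 2 j)) ([m+n]%n≡m%n j 2)
    ordinary-split : special d ≡ false → _
    ordinary-split ord = begin
      mulAt d (oddW d) Y m
        ≡⟨ mulAt-congφ d Y m oddW≗1 ⟩
      mulAt d (const 1) Y m
        ≡⟨ mulAt-geometric d>0 Y m ⟩
      mulAt d upToOne (mulAt (double d) (const 1) Y) m
        ≡⟨ mulAt-congφ d _ m distinctW≗upToOne ⟨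
      mulAt d (distinctW d) (mulAt (double d) (const 1) Y) m ∎
      where
      oddW≗1 : ∀ j → oddW d j ≡ 1
      oddW≗1 j = cong₂ (λ a b → (if a then (if b then (_% 2) else const 1) else δ₀) j) d-odd ord
      distinctW≗upToOne : ∀ j → distinctW d j ≡ upToOne j
      distinctW≗upToOne j = cong (λ b → (if b then exactlyOne else upToOne) j) ord

  weighted-euler : ∀ L n → n ≤ L → p ≤ L → mulUpTo L distinctW δ₀ n ≡ mulUpTo L oddW δ₀ n
  weighted-euler L n n≤L p≤L =
    mulUpTo-glaisher L distinctW-double (distinctW-large p≤L) oddW-split oddW-even n n≤L
      (λ i 2i≤n → euler L i (≤-trans (≤-double i) (≤-trans 2i≤n n≤L)))

-- Sums over enumerated partitions

indicator : Bool → ℕ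
indicator true  = 1
indicator false = 0

indicator-∧ : ∀ a b → indicator (a ∧ b) ≡ indicator a * indicator b
indicator-∧ true  b = sym (+-identityʳ _)
indicator-∧ false b = refl

sumMap : {A : Set} → (A → ℕ) → List A → ℕ
sumMap w xs = sum (map w xs)

module _ {A : Set} where

  sumMap-++ : ∀ (w : A → ℕ) xs ys → sumMap w (xs ++ ys) ≡ sumMap w xs + sumMap w ys
  sumMap-++ w xs ys = trans (cong sum (map-++ w xs ys)) (sum-++ (map w xs) (map w ys))

  sumMap-map : ∀ {B : Set} (w : B → ℕ) (g : A → B) xs → sumMap w (map g xs) ≡ sumMap (w ∘ g) xs
  sumMap-map w g xs = cong sum (sym (map-∘ xs))

  sumMap-cong : ∀ {w v : A → ℕ} xs → (∀ x → w x ≡ v x) → sumMap w xs ≡ sumMap v xs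
  sumMap-cong xs w≗v = cong sum (map-cong w≗v xs)

  sumMap-cong-All : ∀ {P : A → Set} {w v : A → ℕ} {xs} → All P xs → (∀ {x} → P x → w x ≡ v x) →
                    sumMap w xs ≡ sumMap v xs
  sumMap-cong-All all-P eq = cong sum (map-cong-local (All.map eq all-P))

  sumMap-* : ∀ c (w : A → ℕ) xs → sumMap (λ x → c * w x) xs ≡ c * sumMap w xs
  sumMap-* c w []       = sym (*-zeroʳ c)
  sumMap-* c w (x ∷ xs) = trans (cong (c * w x +_) (sumMap-* c w xs)) (sym (*-distribˡ-+ c (w x) _))

  sumMap-filterᵇ : ∀ (P : A → Bool) (w : A → ℕ) xs →
                   sumMap w (filterᵇ P xs) ≡ sumMap (λ x → indicator (P x) * w x) xs
  sumMap-filterᵇ P w []       = refl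
  sumMap-filterᵇ P w (x ∷ xs) with P x
  ... | true  = cong₂ _+_ (sym (+-identityʳ (w x))) (sumMap-filterᵇ P w xs)
  ... | false = sumMap-filterᵇ P w xs

  sumMap-mono : ∀ {w v : A → ℕ} xs → (∀ x → w x ≤ v x) → sumMap w xs ≤ sumMap v xs
  sumMap-mono []       w≤v = z≤n
  sumMap-mono (x ∷ xs) w≤v = +-mono-≤ (w≤v x) (sumMap-mono xs w≤v)

  sumMap-%2 : ∀ {w v : A → ℕ} xs → (∀ x → w x % 2 ≡ v x % 2) → sumMap w xs % 2 ≡ sumMap v xs % 2
  sumMap-%2 []                 w≡v = refl
  sumMap-%2 {w = w} {v} (x ∷ xs) w≡v = begin
    (w x + sumMap w xs) % 2              ≡⟨ %-distribˡ-+ (w x) _ 2 ⟩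
    (w x % 2 + sumMap w xs % 2) % 2      ≡⟨ cong₂ (λ a b → (a + b) % 2) (w≡v x) (sumMap-%2 xs w≡v) ⟩
    (v x % 2 + sumMap v xs % 2) % 2      ≡⟨ %-distribˡ-+ (v x) _ 2 ⟨
    (v x + sumMap v xs) % 2              ∎

largestPart : ℕ → ℕ → ℕ → List (List ℕ)
largestPart f n k = if suc k ≤ᵇ suc n then map (suc k ∷_) (partsAtMostF f (suc k) (n ∸ k)) else []

partsAtMost-suc : ∀ f m n →
  partsAtMostF (suc f) (suc m) (suc n) ≡ partsAtMostF (suc f) m (suc n) ++ largestPart f n m
partsAtMost-suc f m n = begin
  concatMap (largestPart f n) (upTo (suc m))
    ≡⟨ cong (concatMap (largestPart f n)) (applyUpTo-∷ʳ _ m) ⟨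
  concatMap (largestPart f n) (upTo m ++ [ m ])
    ≡⟨ concatMap-++ (largestPart f n) (upTo m) [ m ] ⟩
  partsAtMostF (suc f) m (suc n) ++ (largestPart f n m ++ [])
    ≡⟨ cong (partsAtMostF (suc f) m (suc n) ++_) (++-identityʳ _) ⟩
  partsAtMostF (suc f) m (suc n) ++ largestPart f n m ∎

largestPart-≤ : ∀ f {n m} → m ≤ n → largestPart f n m ≡ map (suc m ∷_) (partsAtMostF f (suc m) (n ∸ m))
largestPart-≤ f {n} {m} m≤n =
  cong (λ b → if b then map (suc m ∷_) (partsAtMostF f (suc m) (n ∸ m)) else []) (≤ᵇ-true (s≤s m≤n))

largestPart-> : ∀ f {n m} → n < m → largestPart f n m ≡ []
largestPart-> f {n} {m} n<m =
  cong (λ b → if b then map (suc m ∷_) (partsAtMostF f (suc m) (n ∸ m)) else []) (≤ᵇ-false (s≤s n<m))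

partsAtMost-bounded : ∀ f m n → All (All (_≤ m)) (partsAtMostF f m n)
partsAtMost-bounded zero    m n       = []
partsAtMost-bounded (suc f) m zero    = [] ∷ []
partsAtMost-bounded (suc f) m (suc n) = concat⁺ (map⁺ (applyUpTo⁺₁ _ m block-bounded))
  where
  block-bounded : ∀ {k} → k < m → All (All (_≤ m)) (largestPart f n k)
  block-bounded {k} k<m with suc k ≤ᵇ suc n
  ... | true  = map⁺ (All.map (λ parts≤ → k<m ∷ All.map (λ i≤k → ≤-trans i≤k k<m) parts≤)
                       (partsAtMost-bounded f (suc k) (n ∸ k)))
  ... | false = []

partsAtMost-stable : ∀ k f m n → n ≤ m → partsAtMostF f (k + m) n ≡ partsAtMostF f m n
partsAtMost-stable zero    f m n n≤m = refl
partsAtMost-stable (suc k) f m n n≤m =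
  trans (step f (k + m) n (≤-trans n≤m (m≤n+m m k))) (partsAtMost-stable k f m n n≤m)
  where
  step : ∀ f m n → n ≤ m → partsAtMostF f (suc m) n ≡ partsAtMostF f m n
  step zero    m n       _   = refl
  step (suc f) m zero    _   = refl
  step (suc f) m (suc n) n<m = trans (partsAtMost-suc f m n)
    (trans (cong (partsAtMostF (suc f) m (suc n) ++_) (largestPart-> f n<m)) (++-identityʳ _))

replicate-++-∷ : ∀ j (a : ℕ) μ → replicate j a ++ (a ∷ μ) ≡ replicate (suc j) a ++ μ
replicate-++-∷ zero    a μ = refl
replicate-++-∷ (suc j) a μ = cong (a ∷_) (replicate-++-∷ j a μ)

module MultiplicativeWeight (w : ℕ → List ℕ → ℕ) (Φ : Family) (w-[] : w 0 [] ≡ 1)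
  (w-peel : ∀ m j μ → All (_≤ m) μ → w (suc m) (replicate j (suc m) ++ μ) ≡ Φ (suc m) j * w m μ)
  where

  private
    blocks : ∀ m → (∀ f n → n < f → sumMap (w m) (partsAtMostF f m n) ≡ mulUpTo m Φ δ₀ n) →
      ∀ j f n → n < f →
      sumMap (λ μ → w (suc m) (replicate j (suc m) ++ μ)) (partsAtMostF f (suc m) n)
        ≡ mulAt (suc m) (λ i → Φ (suc m) (j + i)) (mulUpTo m Φ δ₀) n
    blocks m IH j (suc f) zero _ = begin
      w (suc m) (replicate j (suc m) ++ []) + 0
        ≡⟨ +-identityʳ _ ⟩
      w (suc m) (replicate j (suc m) ++ [])
        ≡⟨ w-peel m j [] [] ⟩
      Φ (suc m) j * w m []
        ≡⟨ cong₂ _*_ (cong (Φ (suc m)) (sym (+-identityʳ j)))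
             (trans (sym (+-identityʳ _)) (IH (suc f) zero (s≤s z≤n))) ⟩
      Φ (suc m) (j + 0) * mulUpTo m Φ δ₀ 0
        ≡⟨ mulAt-below {suc m} (λ i → Φ (suc m) (j + i)) (mulUpTo m Φ δ₀) (s≤s z≤n) ⟨
      mulAt (suc m) (λ i → Φ (suc m) (j + i)) (mulUpTo m Φ δ₀) 0 ∎
    blocks m IH j (suc f) (suc n) (s≤s n<f) = begin
      sumMap W (partsAtMostF (suc f) (suc m) (suc n))
        ≡⟨ cong (sumMap W) (partsAtMost-suc f m n) ⟩
      sumMap W (partsAtMostF (suc f) m (suc n) ++ largestPart f n m)
        ≡⟨ sumMap-++ W (partsAtMostF (suc f) m (suc n)) (largestPart f n m) ⟩
      sumMap W (partsAtMostF (suc f) m (suc n)) + sumMap W (largestPart f n m)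
        ≡⟨ cong₂ _+_ smaller-parts (largest-part (m ≤? n)) ⟩
      φ 0 * Y (suc n) + shift (suc m) (mulAt (suc m) (φ ∘ suc) Y) (suc n)
        ≡⟨ mulAt-unfold {suc m} (s≤s z≤n) φ Y (suc n) ⟨
      mulAt (suc m) φ Y (suc n) ∎
      where
      W : List ℕ → ℕ
      W μ = w (suc m) (replicate j (suc m) ++ μ)
      φ : ℕ → ℕ
      φ i = Φ (suc m) (j + i)
      Y : Series
      Y = mulUpTo m Φ δ₀

      smaller-parts : sumMap W (partsAtMostF (suc f) m (suc n)) ≡ φ 0 * Y (suc n)
      smaller-parts = begin
        sumMap W (partsAtMostF (suc f) m (suc n))
          ≡⟨ sumMap-cong-All (partsAtMost-bounded (suc f) m (suc n)) (λ {μ} → w-peel m j μ) ⟩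
        sumMap (λ μ → Φ (suc m) j * w m μ) (partsAtMostF (suc f) m (suc n))
          ≡⟨ sumMap-* (Φ (suc m) j) (w m) (partsAtMostF (suc f) m (suc n)) ⟩
        Φ (suc m) j * sumMap (w m) (partsAtMostF (suc f) m (suc n))
          ≡⟨ cong₂ _*_ (cong (Φ (suc m)) (sym (+-identityʳ j))) (IH (suc f) (suc n) (s≤s n<f)) ⟩
        φ 0 * Y (suc n) ∎

      largest-part : Dec (m ≤ n) → sumMap W (largestPart f n m) ≡ shift (suc m) (mulAt (suc m) (φ ∘ suc) Y) (suc n)
      largest-part (no m≰n) =
        trans (cong (sumMap W) (largestPart-> f (≰⇒> m≰n))) (sym (shift-> (s≤s (≰⇒> m≰n))))
      largest-part (yes m≤n) = begin
        sumMap W (largestPart f n m)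
          ≡⟨ cong (sumMap W) (largestPart-≤ f m≤n) ⟩
        sumMap W (map (suc m ∷_) (partsAtMostF f (suc m) (n ∸ m)))
          ≡⟨ sumMap-map W (suc m ∷_) (partsAtMostF f (suc m) (n ∸ m)) ⟩
        sumMap (λ μ → W (suc m ∷ μ)) (partsAtMostF f (suc m) (n ∸ m))
          ≡⟨ sumMap-cong (partsAtMostF f (suc m) (n ∸ m))
               (λ μ → cong (w (suc m)) (replicate-++-∷ j (suc m) μ)) ⟩
        sumMap (λ μ → w (suc m) (replicate (suc j) (suc m) ++ μ)) (partsAtMostF f (suc m) (n ∸ m))
          ≡⟨ blocks m IH (suc j) f (n ∸ m) (≤-<-trans (m∸n≤m n m) n<f) ⟩
        mulAt (suc m) (λ i → Φ (suc m) (suc j + i)) Y (n ∸ m)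
          ≡⟨ mulAt-congφ (suc m) Y (n ∸ m) (λ i → cong (Φ (suc m)) (sym (+-suc j i))) ⟩
        mulAt (suc m) (φ ∘ suc) Y (n ∸ m)
          ≡⟨ shift-≤ (s≤s m≤n) ⟨
        shift (suc m) (mulAt (suc m) (φ ∘ suc) Y) (suc n) ∎

  sumMap-partsAtMost : ∀ m f n → n < f → sumMap (w m) (partsAtMostF f m n) ≡ mulUpTo m Φ δ₀ n
  sumMap-partsAtMost zero    (suc f) zero    _   = trans (+-identityʳ _) w-[]
  sumMap-partsAtMost zero    (suc f) (suc n) _   = refl
  sumMap-partsAtMost (suc m) f       n       n<f = blocks m (sumMap-partsAtMost m) 0 f n n<f

-- Multiplicities of 1 and p

mult-∷ : ∀ c a ν → mult c (a ∷ ν) ≡ indicator (a ≡ᵇ c) + mult c ν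
mult-∷ c a ν with a ≡ᵇ c
... | true  = refl
... | false = refl

mult-++ : ∀ c μ ν → mult c (μ ++ ν) ≡ mult c μ + mult c ν
mult-++ c []      ν = refl
mult-++ c (a ∷ μ) ν = begin
  mult c (a ∷ μ ++ ν)                      ≡⟨ mult-∷ c a (μ ++ ν) ⟩
  indicator (a ≡ᵇ c) + mult c (μ ++ ν)      ≡⟨ cong (indicator (a ≡ᵇ c) +_) (mult-++ c μ ν) ⟩
  indicator (a ≡ᵇ c) + (mult c μ + mult c ν) ≡⟨ +-assoc (indicator (a ≡ᵇ c)) _ _ ⟨
  (indicator (a ≡ᵇ c) + mult c μ) + mult c ν ≡⟨ cong (_+ mult c ν) (mult-∷ c a μ) ⟨
  mult c (a ∷ μ) + mult c ν                ∎

mult-replicate : ∀ c a j μ → mult c (replicate j a ++ μ) ≡ (if a ≡ᵇ c then j else 0) + mult c μ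
mult-replicate c a zero    μ with a ≡ᵇ c
... | true  = refl
... | false = refl
mult-replicate c a (suc j) μ with a ≡ᵇ c | mult-replicate c a j μ
... | true  | IH = cong suc IH
... | false | IH = IH

mult-bounded : ∀ {c m μ} → All (_≤ m) μ → m < c → mult c μ ≡ 0
mult-bounded []               m<c = refl
mult-bounded {c} {μ = a ∷ μ} (a≤m ∷ a≤ms) m<c =
  trans (mult-∷ c a μ)
    (cong₂ _+_ (cong indicator (≡ᵇ-false (<⇒≢ (≤-<-trans a≤m m<c)))) (mult-bounded a≤ms m<c))

allOdd-replicate : ∀ j a μ → allOdd (replicate j a ++ μ) ≡ ((j ≡ᵇ 0) ∨ isOdd a) ∧ allOdd μ
allOdd-replicate zero    a μ = refl
allOdd-replicate (suc j) a μ rewrite allOdd-replicate j a μ with isOdd a | j ≡ᵇ 0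
... | false | _     = refl
... | true  | true  = refl
... | true  | false = refl

strictDec-replicate : ∀ j m μ → All (_≤ m) μ →
                      strictDec (replicate j (suc m) ++ μ) ≡ (j ≤ᵇ 1) ∧ strictDec μ
strictDec-replicate zero          m μ       _         = refl
strictDec-replicate (suc zero)    m []      _         = refl
strictDec-replicate (suc zero)    m (a ∷ μ) (a≤m ∷ _) rewrite ≤ᵇ-false {suc m} {a} (s≤s a≤m) = refl
strictDec-replicate (suc (suc j)) m μ       _         rewrite ≤ᵇ-true {suc m} {suc m} ≤-refl = refl

module PrimeProducts (p : ℕ) (p-prime : Prime p) (1<p : 1 < p) where

  private
    𝕀[_≡_] : ℕ → ℕ → ℕ
    𝕀[ a ≡ b ] = indicator (a ≡ᵇ b)

    𝕀-yes : ∀ {a b} → a ≡ b → 𝕀[ a ≡ b ] ≡ 1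
    𝕀-yes a≡b = cong indicator (≡ᵇ-true a≡b)

    𝕀-no : ∀ {a b} → a ≢ b → 𝕀[ a ≡ b ] ≡ 0
    𝕀-no a≢b = cong indicator (≡ᵇ-false a≢b)

  p≢1 : p ≢ 1
  p≢1 = >⇒≢ 1<p

  product≡p : ∀ x y → 𝕀[ x * y ≡ p ] ≡ 𝕀[ x ≡ 1 ] * 𝕀[ y ≡ p ] + 𝕀[ x ≡ p ] * 𝕀[ y ≡ 1 ]
  product≡p x y with x ≟ 1 | x ≟ p
  ... | yes refl | _ rewrite 𝕀-no {1} {p} (p≢1 ∘ sym) | *-identityˡ y =
        sym (trans (+-identityʳ _) (+-identityʳ _))
  ... | no x≢1 | yes refl rewrite 𝕀-no p≢1 | 𝕀-yes {p} refl with y ≟ 1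
  ...   | yes refl rewrite *-identityʳ p | 𝕀-yes {p} refl = refl
  ...   | no y≢1 rewrite 𝕀-no y≢1 = 𝕀-no λ py≡p →
          y≢1 (*-cancelˡ-≡ y 1 p {{>-nonZero (<-trans (s≤s z≤n) 1<p)}} (trans py≡p (sym (*-identityʳ p))))
  product≡p x y | no x≢1 | no x≢p rewrite 𝕀-no x≢1 | 𝕀-no x≢p = 𝕀-no λ xy≡p →
    [ x≢1 , x≢p ]′ (prime⇒irreducible p-prime (divides y (trans (sym xy≡p) (*-comm x y))))

  mult-map-* : ∀ x ys → mult p (map (x *_) ys) ≡ 𝕀[ x ≡ 1 ] * mult p ys + 𝕀[ x ≡ p ] * mult 1 ys
  mult-map-* x []       = sym (cong₂ _+_ (*-zeroʳ 𝕀[ x ≡ 1 ]) (*-zeroʳ 𝕀[ x ≡ p ]))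
  mult-map-* x (y ∷ ys) = begin
    mult p (x * y ∷ map (x *_) ys)
      ≡⟨ mult-∷ p (x * y) _ ⟩
    𝕀[ x * y ≡ p ] + mult p (map (x *_) ys)
      ≡⟨ cong₂ _+_ (product≡p x y) (mult-map-* x ys) ⟩
    (a * 𝕀[ y ≡ p ] + b * 𝕀[ y ≡ 1 ]) + (a * mult p ys + b * mult 1 ys)
      ≡⟨ regroup a b 𝕀[ y ≡ p ] 𝕀[ y ≡ 1 ] (mult p ys) (mult 1 ys) ⟩
    a * (𝕀[ y ≡ p ] + mult p ys) + b * (𝕀[ y ≡ 1 ] + mult 1 ys)
      ≡⟨ cong₂ (λ s t → a * s + b * t) (mult-∷ p y ys) (mult-∷ 1 y ys) ⟨
    a * mult p (y ∷ ys) + b * mult 1 (y ∷ ys) ∎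
    where
    a = 𝕀[ x ≡ 1 ]
    b = 𝕀[ x ≡ p ]
    regroup : ∀ a b s t u v → (a * s + b * t) + (a * u + b * v) ≡ a * (s + u) + b * (t + v)
    regroup = solve-∀

  mult-pre₂ : ∀ l → mult p (pre₂ l) ≡ mult 1 l * mult p l
  mult-pre₂ []       = refl
  mult-pre₂ (x ∷ xs) = begin
    mult p (map (x *_) xs ++ pre₂ xs)
      ≡⟨ mult-++ p (map (x *_) xs) (pre₂ xs) ⟩
    mult p (map (x *_) xs) + mult p (pre₂ xs)
      ≡⟨ cong₂ _+_ (mult-map-* x xs) (mult-pre₂ xs) ⟩
    (a * mult p xs + b * mult 1 xs) + mult 1 xs * mult p xs
      ≡⟨ cong (_+ ((a * mult p xs + b * mult 1 xs) + mult 1 xs * mult p xs)) (not-both x) ⟨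
    a * b + ((a * mult p xs + b * mult 1 xs) + mult 1 xs * mult p xs)
      ≡⟨ expand a b (mult 1 xs) (mult p xs) ⟨
    (a + mult 1 xs) * (b + mult p xs)
      ≡⟨ cong₂ _*_ (mult-∷ 1 x xs) (mult-∷ p x xs) ⟨
    mult 1 (x ∷ xs) * mult p (x ∷ xs) ∎
    where
    a = 𝕀[ x ≡ 1 ]
    b = 𝕀[ x ≡ p ]
    expand : ∀ a b m n → (a + m) * (b + n) ≡ a * b + ((a * n + b * m) + m * n)
    expand = solve-∀
    not-both : ∀ x → 𝕀[ x ≡ 1 ] * 𝕀[ x ≡ p ] ≡ 0
    not-both x with x ≟ 1
    ... | yes refl rewrite 𝕀-no {1} {p} (p≢1 ∘ sym) = refl
    ... | no x≢1   rewrite 𝕀-no x≢1 = refl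

-- At stage m only parts ≤ m have been placed, so the factor for a part c > m is still 1.
module CappedWeights (p : ℕ) (1<p : 1 < p) where

  capped : ℕ → ℕ → ℕ → ℕ
  capped c m x = if c ≤ᵇ m then x else 1

  weight : (List ℕ → Bool) → (ℕ → ℕ) → ℕ → List ℕ → ℕ
  weight valid f m μ = indicator (valid μ) * (capped 1 m (f (mult 1 μ)) * capped p m (f (mult p μ)))

  factor : (ℕ → ℕ → Bool) → (ℕ → ℕ) → Family
  factor v f d j = indicator (v d j) * ((if d ≡ᵇ 1 then f j else 1) * (if d ≡ᵇ p then f j else 1))

  capped-peel : ∀ (f : ℕ → ℕ) c m j μ → All (_≤ m) μ →
    capped c (suc m) (f (mult c (replicate j (suc m) ++ μ))) ≡
    (if suc m ≡ᵇ c then f j else 1) * capped c m (f (mult c μ))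
  capped-peel f c m j μ μ≤m rewrite mult-replicate c (suc m) j μ with <-cmp c (suc m)
  ... | tri< c<1+m _ _ rewrite ≤ᵇ-true (<⇒≤ c<1+m) | ≤ᵇ-true (≤-pred c<1+m) | ≡ᵇ-false (>⇒≢ c<1+m) =
        sym (+-identityʳ _)
  ... | tri≈ _ refl _ rewrite ≤ᵇ-true {suc m} ≤-refl | ≤ᵇ-false {suc m} {m} ≤-refl | ≡ᵇ-true {suc m} refl
                            | mult-bounded μ≤m (n<1+n m) =
        trans (cong f (+-identityʳ j)) (sym (*-identityʳ _))
  ... | tri> _ _ 1+m<c rewrite ≤ᵇ-false 1+m<c | ≤ᵇ-false (<-trans (n<1+n m) 1+m<c)
                             | ≡ᵇ-false (<⇒≢ 1+m<c) = refl

  weight-[] : ∀ {valid} f → valid [] ≡ true → weight valid f 0 [] ≡ 1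
  weight-[] f valid-[] rewrite valid-[] | ≤ᵇ-false {p} {0} (<-trans (s≤s z≤n) 1<p) = refl

  weight-peel : ∀ {valid v} f →
    (∀ m j μ → All (_≤ m) μ → valid (replicate j (suc m) ++ μ) ≡ v (suc m) j ∧ valid μ) →
    ∀ m j μ → All (_≤ m) μ →
    weight valid f (suc m) (replicate j (suc m) ++ μ) ≡ factor v f (suc m) j * weight valid f m μ
  weight-peel {valid} {v} f valid-peel m j μ μ≤m
    rewrite valid-peel m j μ μ≤m | indicator-∧ (v (suc m) j) (valid μ)
          | capped-peel f 1 m j μ μ≤m | capped-peel f p m j μ μ≤m =
      shuffle (indicator (v (suc m) j)) (indicator (valid μ)) (if suc m ≡ᵇ 1 then f j else 1)
              (capped 1 m (f (mult 1 μ))) (if suc m ≡ᵇ p then f j else 1) (capped p m (f (mult p μ)))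
    where
    shuffle : ∀ x y a f b g → (x * y) * ((a * f) * (b * g)) ≡ (x * (a * b)) * (y * (f * g))
    shuffle = solve-∀

  weight-beyond-p : ∀ valid f {M} → p ≤ M → ∀ μ →
                    weight valid f M μ ≡ indicator (valid μ) * (f (mult 1 μ) * f (mult p μ))
  weight-beyond-p valid f p≤M μ rewrite ≤ᵇ-true (≤-trans (<⇒≤ 1<p) p≤M) | ≤ᵇ-true p≤M = refl

  sumMap-partitions : ∀ {valid v} f → valid [] ≡ true →
    (∀ m j μ → All (_≤ m) μ → valid (replicate j (suc m) ++ μ) ≡ v (suc m) j ∧ valid μ) →
    ∀ n → sumMap (λ μ → indicator (valid μ) * (f (mult 1 μ) * f (mult p μ))) (partitions n) ≡
          mulUpTo (p + n) (factor v f) δ₀ n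
  sumMap-partitions {valid} {v} f valid-[] valid-peel n = begin
    sumMap (λ μ → indicator (valid μ) * (f (mult 1 μ) * f (mult p μ))) (partitions n)
      ≡⟨ sumMap-cong (partitions n) (λ μ → sym (weight-beyond-p valid f (m≤m+n p n) μ)) ⟩
    sumMap (weight valid f (p + n)) (partsAtMostF (suc n) n n)
      ≡⟨ cong (sumMap (weight valid f (p + n))) (partsAtMost-stable p (suc n) n n ≤-refl) ⟨
    sumMap (weight valid f (p + n)) (partsAtMostF (suc n) (p + n) n)
      ≡⟨ MultiplicativeWeight.sumMap-partsAtMost (weight valid f) (factor v f)
           (weight-[] {valid} f valid-[]) (weight-peel {valid} {v} f valid-peel) (p + n) (suc n) n ≤-refl ⟩
    mulUpTo (p + n) (factor v f) δ₀ n ∎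

*-%2 : ∀ b x y → (b * (x * y)) % 2 ≡ (b * (x % 2 * (y % 2))) % 2
*-%2 b x y = begin
  (b * (x * y)) % 2                         ≡⟨ %-distribˡ-* b (x * y) 2 ⟩
  (b % 2 * ((x * y) % 2)) % 2               ≡⟨ cong (λ t → (b % 2 * t) % 2) (%-distribˡ-* x y 2) ⟩
  (b % 2 * ((x % 2 * (y % 2)) % 2)) % 2     ≡⟨ %-distribˡ-* b (x % 2 * (y % 2)) 2 ⟨
  (b * (x % 2 * (y % 2))) % 2               ∎

module OddPrime (p : ℕ) (p-prime : Prime p) (p%2≡1 : p % 2 ≡ 1) where

  1<p : 1 < p
  1<p = nonTrivial⇒n>1 p {{prime⇒nonTrivial p-prime}}

  p-odd : oddᵇ p ≡ true
  p-odd = trans (sym (isOdd≡oddᵇ p)) (cong (_≡ᵇ 1) p%2≡1)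

  open PrimeProducts p p-prime 1<p
  open CappedWeights p 1<p
  open WeightedGlaisher p 1<p p-odd

  countParts-filter : ∀ P Λ →
                      countParts p (filterᵇ P Λ) ≡ sumMap (λ l → indicator (P l) * (mult 1 l * mult p l)) Λ
  countParts-filter P Λ = begin
    sumMap (mult p ∘ pre₂) (filterᵇ atLeastTwo (filterᵇ P Λ))
      ≡⟨ sumMap-filterᵇ atLeastTwo (mult p ∘ pre₂) (filterᵇ P Λ) ⟩
    sumMap (λ l → indicator (atLeastTwo l) * mult p (pre₂ l)) (filterᵇ P Λ)
      ≡⟨ sumMap-cong (filterᵇ P Λ) short-pre₂ ⟩
    sumMap (mult p ∘ pre₂) (filterᵇ P Λ)
      ≡⟨ sumMap-filterᵇ P (mult p ∘ pre₂) Λ ⟩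
    sumMap (λ l → indicator (P l) * mult p (pre₂ l)) Λ
      ≡⟨ sumMap-cong Λ (λ l → cong (indicator (P l) *_) (mult-pre₂ l)) ⟩
    sumMap (λ l → indicator (P l) * (mult 1 l * mult p l)) Λ ∎
    where
    short-pre₂ : ∀ l → indicator (atLeastTwo l) * mult p (pre₂ l) ≡ mult p (pre₂ l)
    short-pre₂ []          = refl
    short-pre₂ (_ ∷ [])    = refl
    short-pre₂ (_ ∷ _ ∷ _) = *-identityˡ _

  distinctFactor≗distinctW : ∀ d j → factor (λ _ j → j ≤ᵇ 1) id d j ≡ distinctW d j
  distinctFactor≗distinctW d j with d ≟ 1 | d ≟ p
  ... | yes refl | _       rewrite ≡ᵇ-false {1} {p} (p≢1 ∘ sym) = exactly-one j
    where
    exactly-one : ∀ j → indicator (j ≤ᵇ 1) * (j * 1) ≡ exactlyOne j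
    exactly-one zero          = refl
    exactly-one (suc zero)    = refl
    exactly-one (suc (suc j)) = refl
  ... | no d≢1   | yes refl rewrite ≡ᵇ-false p≢1 | ≡ᵇ-true {p} refl = exactly-one j
    where
    exactly-one : ∀ j → indicator (j ≤ᵇ 1) * (1 * j) ≡ exactlyOne j
    exactly-one zero          = refl
    exactly-one (suc zero)    = refl
    exactly-one (suc (suc j)) = refl
  ... | no d≢1   | no d≢p   rewrite ≡ᵇ-false d≢1 | ≡ᵇ-false d≢p = up-to-one j
    where
    up-to-one : ∀ j → indicator (j ≤ᵇ 1) * (1 * 1) ≡ upToOne j
    up-to-one zero          = refl
    up-to-one (suc zero)    = refl
    up-to-one (suc (suc j)) = refl

  oddFactor≗oddW : ∀ d j → factor (λ d j → (j ≡ᵇ 0) ∨ isOdd d) (_% 2) d j ≡ oddW d j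
  oddFactor≗oddW d j rewrite isOdd≡oddᵇ d with oddᵇ d in d-parity
  ... | false rewrite ≡ᵇ-false (parity-≢ {d} {1} d-parity refl)
                    | ≡ᵇ-false (parity-≢ {d} {p} d-parity p-odd) = even-factor j
    where
    even-factor : ∀ j → indicator ((j ≡ᵇ 0) ∨ false) * (1 * 1) ≡ δ₀ j
    even-factor zero    = refl
    even-factor (suc j) = refl
  ... | true rewrite ∨-zeroʳ (j ≡ᵇ 0) with d ≟ 1 | d ≟ p
  ...   | yes refl | _       rewrite ≡ᵇ-false {1} {p} (p≢1 ∘ sym) = trans (+-identityʳ _) (*-identityʳ _)
  ...   | no d≢1   | yes refl rewrite ≡ᵇ-false p≢1 | ≡ᵇ-true {p} refl = trans (+-identityʳ _) (+-identityʳ _)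
  ...   | no d≢1   | no d≢p   rewrite ≡ᵇ-false d≢1 | ≡ᵇ-false d≢p = refl

  oddSum : (ℕ → ℕ) → ℕ → ℕ
  oddSum f n = sumMap (λ l → indicator (allOdd l) * (f (mult 1 l) * f (mult p l))) (partitions n)

  o₂≡oddSum : ∀ n → o₂ p n ≡ oddSum id n
  o₂≡oddSum n = countParts-filter allOdd (partitions n)

  d₂≡oddSum : ∀ n → d₂ p n ≡ oddSum (_% 2) n
  d₂≡oddSum n = begin
    d₂ p n
      ≡⟨ countParts-filter strictDec (partitions n) ⟩
    sumMap (λ l → indicator (strictDec l) * (mult 1 l * mult p l)) (partitions n)
      ≡⟨ sumMap-partitions {strictDec} {λ _ j → j ≤ᵇ 1} id refl (λ m j μ → strictDec-replicate j m μ) n ⟩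
    mulUpTo (p + n) (factor (λ _ j → j ≤ᵇ 1) id) δ₀ n
      ≡⟨ mulUpTo-congF (p + n) δ₀ n (λ {d} _ _ → distinctFactor≗distinctW d) ⟩
    mulUpTo (p + n) distinctW δ₀ n
      ≡⟨ weighted-euler (p + n) n (m≤n+m n p) (m≤m+n p n) ⟩
    mulUpTo (p + n) oddW δ₀ n
      ≡⟨ mulUpTo-congF (p + n) δ₀ n (λ {d} _ _ → oddFactor≗oddW d) ⟨
    mulUpTo (p + n) (factor (λ d j → (j ≡ᵇ 0) ∨ isOdd d) (_% 2)) δ₀ n
      ≡⟨ sumMap-partitions {allOdd} {λ d j → (j ≡ᵇ 0) ∨ isOdd d} (_% 2) refl
           (λ m j μ _ → allOdd-replicate j (suc m) μ) n ⟨
    oddSum (_% 2) n ∎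

theorem3p9 : (n p : ℕ) → Prime p → p % 2 ≡ 1 →
    d₂ p n ≤ o₂ p n × o₂ p n % 2 ≡ d₂ p n % 2
theorem3p9 n p p-prime p%2≡1 =
  subst₂ _≤_ (sym (d₂≡oddSum n)) (sym (o₂≡oddSum n)) (sumMap-mono (partitions n) parity≤) ,
  (begin
    o₂ p n % 2              ≡⟨ cong (_% 2) (o₂≡oddSum n) ⟩
    oddSum id n % 2         ≡⟨ sumMap-%2 (partitions n) (λ l → *-%2 (indicator (allOdd l)) (mult 1 l) (mult p l)) ⟩
    oddSum (_% 2) n % 2     ≡⟨ cong (_% 2) (d₂≡oddSum n) ⟨
    d₂ p n % 2              ∎)
  where
  open OddPrime p p-prime p%2≡1

  parity≤ : ∀ l → indicator (allOdd l) * (mult 1 l % 2 * (mult p l % 2)) ≤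
                  indicator (allOdd l) * (mult 1 l * mult p l)
  parity≤ l = *-monoʳ-≤ (indicator (allOdd l)) (*-mono-≤ (m%n≤m (mult 1 l) 2) (m%n≤m (mult p l) 2))
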